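{- Let $n,k$ be positive integers with $4\le 2k\le n$, and let $G,H\subseteq[n]$ be subsets with at most $k$ elements each. The following are equivalent: (i) $G$ and $H$ are strongly intersecting; (ii) the families $\mathcal{F}(G)=\{S\in\binom{[n]}{k}:S\preceq G\}$ and $\mathcal{F}(H)=\{S\in\binom{[n]}{k}:S\preceq H\}$ are cross-intersecting; (iii) there exists $1\le l\le n$ such that $\mu_G(l)+\mu_H(l)>l$.
   Context: $[n]=\{1,\dots,n\}$; $\binom{[n]}{k}$ is the collection of $k$-subsets of $[n]$; sets are listed in increasing order. For $A=\{a_1<\dots<a_r\}$ and $B=\{b_1<\dots<b_s\}$, $A\preceq B$ means $r\ge s$ and $a_i\le b_i$ for $1\le i\le s$; for sets of equal size $r$, $A\le B$ means $a_i\le b_i$ for $1\le i\le r$. Two sets $A,B$ are strongly intersecting if for all $A',B'\subseteq[n]$ with $|A'|=|A|$, $A'\le A$, $|B'|=|B|$, $B'\le B$, one has $A'\cap B'\neq\emptyset$. Families $\mathcal{A},\mathcal{B}$ are cross-intersecting if $A\cap B\neq\emptyset$ for all $A\in\mathcal{A}$, $B\in\mathcal{B}$. For $X\subseteq[n]$, $\mu_X(l)=|X\cap[l]|$. -}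

module Defs where

open import Data.Nat using (ℕ; zero; suc; _≤_; _<_; _≤ᵇ_)
open import Data.Bool using (Bool; true; false; if_then_else_)
open import Data.Vec using (Vec; []; _∷_)
open import Data.List using (List; []; _∷_; length)
open import Data.Unit using (⊤)
open import Data.Empty using (⊥)
open import Data.Product using (_×_)
open import Relation.Binary.PropositionalEquality using (_≡_)
open import Data.Fin.Subset using (Subset; ∣_∣; _∩_; Nonempty)

-- A subset X of [n] is a 'Subset n'; position i : Fin n stands for the
-- element (toℕ i + 1) of [n] = {1,…,n}.

elemsFrom : {m : ℕ} → ℕ → Vec Bool m → List ℕ
elemsFrom o [] = []
elemsFrom o (true ∷ v) = suc o ∷ elemsFrom (suc o) v
elemsFrom o (false ∷ v) = elemsFrom (suc o) v

elems : {n : ℕ} → Subset n → List ℕ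
elems X = elemsFrom 0 X

PrefLe : List ℕ → List ℕ → Set
PrefLe as [] = ⊤
PrefLe [] (b ∷ bs) = ⊥
PrefLe (a ∷ as) (b ∷ bs) = (a ≤ b) × PrefLe as bs

_⪯_ : {n : ℕ} → Subset n → Subset n → Set
A ⪯ B = PrefLe (elems A) (elems B)

_≤ˢ_ : {n : ℕ} → Subset n → Subset n → Set
A ≤ˢ B = (∣ A ∣ ≡ ∣ B ∣) × PrefLe (elems A) (elems B)

StronglyIntersecting : {n : ℕ} → Subset n → Subset n → Set
StronglyIntersecting {n} A B =
  (A' B' : Subset n) → ∣ A' ∣ ≡ ∣ A ∣ → A' ≤ˢ A → ∣ B' ∣ ≡ ∣ B ∣ → B' ≤ˢ B →
  Nonempty (A' ∩ B')

InF : {n : ℕ} → ℕ → Subset n → Subset n → Set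
InF k G S = (∣ S ∣ ≡ k) × (S ⪯ G)

CrossIntersecting : {n : ℕ} → (Subset n → Set) → (Subset n → Set) → Set
CrossIntersecting {n} 𝒜 ℬ = (A B : Subset n) → 𝒜 A → ℬ B → Nonempty (A ∩ B)

countLe : ℕ → List ℕ → ℕ
countLe l [] = 0
countLe l (x ∷ xs) = if x ≤ᵇ l then suc (countLe l xs) else countLe l xs

μ : {n : ℕ} → Subset n → ℕ → ℕ
μ X l = countLe l (elems X)

{-# OPTIONS --safe #-}
-- If μ_G(l) + μ_H(l) > l for some l, then every S ⪯ G and T ⪯ H satisfy the same
-- inequality, since moving elements down can only raise the counts μ(l); so S and T
-- meet inside [l] by pigeonhole.  Conversely, if μ_G(l) + μ_H(l) ≤ l for all l ∈ [n],
-- merge G and H in increasing order (ties going to G) and send the i-th element of the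
-- merge to i.  The condition ensures that this moves every element down, and the
-- images of G and H are disjoint.  For the families F(G) and F(H), first pad G and H
-- with copies of n up to k elements each: this leaves μ(l) unchanged for l < n, and at
-- l = n the condition becomes 2k ≤ n.
module Submission where

open import Defs
open import Data.Nat using (ℕ; _≤_; _<_; _+_; _*_; zero; suc; _∸_; _≤ᵇ_; z≤n; s≤s; s≤s⁻¹; z<s)
open import Data.Product using (_×_; ∃-syntax; _,_; proj₂; uncurry)
open import Data.Fin.Subset using (Subset; ∣_∣; _∩_; Nonempty; Empty; ⊥)
open import Function.Bundles using (_⇔_; mk⇔)

open import Data.Bool using (Bool; true; false)
open import Data.Empty using (⊥-elim)
open import Data.Fin using (zero; suc)
open import Data.Fin.Subset.Properties using (∉⊥; p∩q⊆p; ∣⊥∣≡0; nonempty?; drop-∷-Empty)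
open import Data.List using (List; []; _∷_; length; _++_; replicate)
open import Data.List.Membership.Propositional using (_∈_)
open import Data.List.Properties using (length-++; length-replicate)
open import Data.List.Relation.Unary.All as All using (All; []; _∷_)
open import Data.List.Relation.Unary.All.Properties using (++⁺; replicate⁺)
open import Data.List.Relation.Unary.Any using (here; there)
open import Data.List.Relation.Unary.Linked as Linked using (Linked; []; [-]; _∷_)
open import Data.List.Relation.Unary.Linked.Properties using (Linked⇒All)
open import Data.Nat.Properties
open import Data.Sum as Sum using (_⊎_; inj₁; inj₂; [_,_]′)
open import Data.Unit using (tt)
open import Data.Vec using (Vec; []; _∷_; here; there)
open import Function using (_∘_)
open import Relation.Binary.PropositionalEquality
  using (_≡_; refl; sym; trans; cong; cong₂; subst; module ≡-Reasoning)
open import Relation.Nullary using (¬_; Dec; yes; no)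
open import Relation.Nullary.Decidable using (decidable-stable; map′; _×-dec_)

countLe-≤ : ∀ {x y} ys → y ≤ x → countLe x (y ∷ ys) ≡ suc (countLe x ys)
countLe-≤ {x} {y} ys y≤x with y ≤ᵇ x | ≤⇒≤ᵇ y≤x
... | true | _ = refl

countLe-> : ∀ {x y} ys → x < y → countLe x (y ∷ ys) ≡ countLe x ys
countLe-> {x} {y} ys x<y with y ≤ᵇ x | ≤ᵇ⇒≤ y x
... | true  | y≤x = ⊥-elim (<⇒≱ x<y (y≤x tt))
... | false | _   = refl

countLe-∷ : ∀ {x} y ys → countLe x ys ≤ countLe x (y ∷ ys)
countLe-∷ {x} y ys with y ≤ᵇ x
... | true  = n≤1+n _
... | false = ≤-refl

countLe-++ : ∀ x xs ys → countLe x (xs ++ ys) ≡ countLe x xs + countLe x ys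
countLe-++ x []       ys = refl
countLe-++ x (y ∷ xs) ys with y ≤ᵇ x
... | true  = cong suc (countLe-++ x xs ys)
... | false = countLe-++ x xs ys

countLe-length : ∀ {x xs} → All (_≤ x) xs → countLe x xs ≡ length xs
countLe-length {xs = []}     []           = refl
countLe-length {xs = y ∷ xs} (y≤x ∷ xs≤x) = trans (countLe-≤ xs y≤x) (cong suc (countLe-length xs≤x))

countLe-zero : ∀ {x xs} → All (x <_) xs → countLe x xs ≡ 0
countLe-zero {xs = []}     []           = refl
countLe-zero {xs = y ∷ xs} (x<y ∷ x<xs) = trans (countLe-> xs x<y) (countLe-zero x<xs)

countLe-antitone : ∀ x as bs → PrefLe as bs → countLe x bs ≤ countLe x as
countLe-antitone x as       []       _ = z≤n
countLe-antitone x (a ∷ as) (b ∷ bs) (a≤b , as≼bs) with b ≤? x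
... | yes b≤x rewrite countLe-≤ bs b≤x | countLe-≤ as (≤-trans a≤b b≤x) =
  s≤s (countLe-antitone x as bs as≼bs)
... | no  b≰x rewrite countLe-> bs (≰⇒> b≰x) =
  ≤-trans (countLe-antitone x as bs as≼bs) (countLe-∷ a as)

PrefLe-++⁻ : ∀ as bs cs → PrefLe as (bs ++ cs) → PrefLe as bs
PrefLe-++⁻ as       []       cs _               = tt
PrefLe-++⁻ (a ∷ as) (b ∷ bs) cs (a≤b , as≼bscs) = a≤b , PrefLe-++⁻ as bs cs as≼bscs

Linked-<-lowerHead : ∀ {a b xs} → a ≤ b → Linked _<_ (b ∷ xs) → Linked _<_ (a ∷ xs)
Linked-<-lowerHead a≤b [-]            = [-]
Linked-<-lowerHead a≤b (b<x ∷ sorted) = ≤-<-trans a≤b b<x ∷ sorted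

replicate-sorted : ∀ r {u} → Linked _≤_ (replicate r u)
replicate-sorted zero          = []
replicate-sorted (suc zero)    = [-]
replicate-sorted (suc (suc r)) = ≤-refl ∷ replicate-sorted (suc r)

++-replicate-sorted : ∀ r {u xs} → All (_≤ u) xs → Linked _≤_ xs → Linked _≤_ (xs ++ replicate r u)
++-replicate-sorted r       []         []             = replicate-sorted r
++-replicate-sorted zero    (_ ∷ [])   [-]            = [-]
++-replicate-sorted (suc r) (x≤u ∷ []) [-]            = x≤u ∷ replicate-sorted (suc r)
++-replicate-sorted r       (_ ∷ xs≤u) (x≤y ∷ sorted) = x≤y ∷ ++-replicate-sorted r xs≤u sorted

Between : ℕ → ℕ → ℕ → Set
Between a b x = a < x × x ≤ b

elemsFrom-increasing : ∀ {m} o (v : Vec Bool m) → Linked _<_ (o ∷ elemsFrom o v)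
elemsFrom-increasing o []          = [-]
elemsFrom-increasing o (true ∷ v)  = n<1+n o ∷ elemsFrom-increasing (suc o) v
elemsFrom-increasing o (false ∷ v) = Linked-<-lowerHead (n≤1+n o) (elemsFrom-increasing (suc o) v)

Between-shift : ∀ {o m x} → Between (suc o) (suc o + m) x → Between o (o + suc m) x
Between-shift {o} {m} (o<x , x≤) = <⇒≤ o<x , ≤-trans x≤ (≤-reflexive (sym (+-suc o m)))

elemsFrom-between : ∀ {m} o (v : Vec Bool m) → All (Between o (o + m)) (elemsFrom o v)
elemsFrom-between o []          = []
elemsFrom-between o (true ∷ v)  =
  (n<1+n o , m<m+n o z<s) ∷ All.map Between-shift (elemsFrom-between (suc o) v)
elemsFrom-between o (false ∷ v) = All.map Between-shift (elemsFrom-between (suc o) v)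

∣∣≡length-elemsFrom : ∀ {m} o (v : Vec Bool m) → ∣ v ∣ ≡ length (elemsFrom o v)
∣∣≡length-elemsFrom o []          = refl
∣∣≡length-elemsFrom o (true ∷ v)  = cong suc (∣∣≡length-elemsFrom (suc o) v)
∣∣≡length-elemsFrom o (false ∷ v) = ∣∣≡length-elemsFrom (suc o) v

countLe-∷-∸ : ∀ l o xs c → countLe l xs + c ≤ l ∸ suc o → countLe l (suc o ∷ xs) + c ≤ l ∸ o
countLe-∷-∸ l o xs c bound with suc o ≤? l
... | yes o<l rewrite countLe-≤ xs o<l = ≤-<-trans bound (∸-monoʳ-< (n<1+n o) o<l)
... | no  o≮l rewrite countLe-> xs (≰⇒> o≮l) = ≤-trans bound (∸-monoʳ-≤ l (n≤1+n o))

countLe-∷-∸ʳ : ∀ l o xs c → c + countLe l xs ≤ l ∸ suc o → c + countLe l (suc o ∷ xs) ≤ l ∸ o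
countLe-∷-∸ʳ l o xs c bound = subst (_≤ l ∸ o) (+-comm _ c)
  (countLe-∷-∸ l o xs c (subst (_≤ l ∸ suc o) (+-comm c _) bound))

Empty-outside∷ : ∀ {m} {p : Subset m} → Empty p → Empty (false ∷ p)
Empty-outside∷ empty (suc i , there i∈p) = empty (i , i∈p)

disjoint⇒countLe≤ : ∀ {m} l o (A B : Vec Bool m) → Empty (A ∩ B) →
  countLe l (elemsFrom o A) + countLe l (elemsFrom o B) ≤ l ∸ o
disjoint⇒countLe≤ l o []          []          _     = z≤n
disjoint⇒countLe≤ l o (true ∷ A)  (true ∷ B)  empty = ⊥-elim (empty (zero , here))
disjoint⇒countLe≤ l o (true ∷ A)  (false ∷ B) empty =
  countLe-∷-∸ l o (elemsFrom (suc o) A) _ (disjoint⇒countLe≤ l (suc o) A B (drop-∷-Empty empty))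
disjoint⇒countLe≤ l o (false ∷ A) (true ∷ B)  empty =
  countLe-∷-∸ʳ l o (elemsFrom (suc o) B) _ (disjoint⇒countLe≤ l (suc o) A B (drop-∷-Empty empty))
disjoint⇒countLe≤ l o (false ∷ A) (false ∷ B) empty =
  ≤-trans (disjoint⇒countLe≤ l (suc o) A B (drop-∷-Empty empty)) (∸-monoʳ-≤ l (n≤1+n o))

-- o is the number of positions already handed out by the merge.
record Hall (o : ℕ) (gs hs : List ℕ) : Set where
  constructor mkHall
  field
    bound : ∀ {x} → x ∈ gs ⊎ x ∈ hs → o + (countLe x gs + countLe x hs) ≤ x

Hall-swap : ∀ {o gs hs} → Hall o gs hs → Hall o hs gs
Hall-swap {o} {gs} {hs} (mkHall bound) = mkHall λ {x} x∈ →
  subst (λ c → o + c ≤ x) (+-comm (countLe x gs) (countLe x hs)) (bound (Sum.swap x∈))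

+-countLe-∷ : ∀ o {x g} gs c → g ≤ x → o + (countLe x (g ∷ gs) + c) ≡ suc o + (countLe x gs + c)
+-countLe-∷ o gs c g≤x rewrite countLe-≤ gs g≤x = +-suc o _

Hall-head : ∀ {o g gs hs} → Hall o (g ∷ gs) hs → o < g
Hall-head {o} {g} {gs} {hs} (mkHall bound) =
  ≤-trans (m≤m+n (suc o) _)
    (subst (_≤ g) (+-countLe-∷ o gs (countLe g hs) ≤-refl) (bound (inj₁ (here refl))))

Hall-drop : ∀ {o g gs hs} → All (g ≤_) gs → All (g ≤_) hs → Hall o (g ∷ gs) hs → Hall (suc o) gs hs
Hall-drop {o} {g} {gs} {hs} g≤gs g≤hs (mkHall bound) = mkHall λ {x} x∈ →
  subst (_≤ x) (+-countLe-∷ o gs (countLe x hs) ([ All.lookup g≤gs , All.lookup g≤hs ]′ x∈))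
    (bound (Sum.map₁ there x∈))

Hall-headʳ : ∀ {o gs h hs} → Hall o gs (h ∷ hs) → o < h
Hall-headʳ = Hall-head ∘ Hall-swap

Hall-dropʳ : ∀ {o gs h hs} → All (h ≤_) gs → All (h ≤_) hs → Hall o gs (h ∷ hs) → Hall (suc o) gs hs
Hall-dropʳ h≤gs h≤hs = Hall-swap ∘ Hall-drop h≤hs h≤gs ∘ Hall-swap

record Separation (m o : ℕ) (gs hs : List ℕ) : Set where
  field
    S T       : Vec Bool m
    ∣S∣≡      : ∣ S ∣ ≡ length gs
    ∣T∣≡      : ∣ T ∣ ≡ length hs
    S≼gs      : PrefLe (elemsFrom o S) gs
    T≼hs      : PrefLe (elemsFrom o T) hs
    disjoint  : Empty (S ∩ T)

empty-separation : ∀ {m o} → Separation m o [] []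
empty-separation {m} = record
  { S = ⊥ ; T = ⊥ ; ∣S∣≡ = ∣⊥∣≡0 m ; ∣T∣≡ = ∣⊥∣≡0 m ; S≼gs = tt ; T≼hs = tt
  ; disjoint = λ (i , i∈) → ∉⊥ (p∩q⊆p ⊥ ⊥ i∈) }

take-left : ∀ {m o g gs hs} → o < g → Separation m (suc o) gs hs → Separation (suc m) o (g ∷ gs) hs
take-left o<g sep = record
  { S = true ∷ S ; T = false ∷ T ; ∣S∣≡ = cong suc ∣S∣≡ ; ∣T∣≡ = ∣T∣≡
  ; S≼gs = o<g , S≼gs ; T≼hs = T≼hs ; disjoint = Empty-outside∷ disjoint }
  where open Separation sep

take-right : ∀ {m o h gs hs} → o < h → Separation m (suc o) gs hs → Separation (suc m) o gs (h ∷ hs)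
take-right o<h sep = record
  { S = false ∷ S ; T = true ∷ T ; ∣S∣≡ = ∣S∣≡ ; ∣T∣≡ = cong suc ∣T∣≡
  ; S≼gs = S≼gs ; T≼hs = o<h , T≼hs ; disjoint = Empty-outside∷ disjoint }
  where open Separation sep

head≤all : ∀ {x xs} → Linked _≤_ (x ∷ xs) → All (x ≤_) xs
head≤all sorted = All.tail (Linked⇒All ≤-trans ≤-refl sorted)

separate : ∀ m o gs hs → length gs + length hs ≤ m → Linked _≤_ gs → Linked _≤_ hs →
  Hall o gs hs → Separation m o gs hs
separate m       o []       []       _   _  _  _    = empty-separation
separate (suc m) o (g ∷ gs) []       len sg _  hall =
  take-left (Hall-head hall)
    (separate m (suc o) gs [] (s≤s⁻¹ len) (Linked.tail sg) [] (Hall-drop (head≤all sg) [] hall))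
separate (suc m) o []       (h ∷ hs) len _  sh hall =
  take-right (Hall-headʳ hall)
    (separate m (suc o) [] hs (s≤s⁻¹ len) [] (Linked.tail sh) (Hall-dropʳ [] (head≤all sh) hall))
separate (suc m) o (g ∷ gs) (h ∷ hs) len sg sh hall with g ≤? h
... | yes g≤h = take-left (Hall-head hall)
  (separate m (suc o) gs (h ∷ hs) (s≤s⁻¹ len) (Linked.tail sg) sh
    (Hall-drop (head≤all sg) (Linked⇒All ≤-trans g≤h sh) hall))
... | no  g≰h = take-right (Hall-headʳ hall)
  (separate m (suc o) (g ∷ gs) hs (s≤s⁻¹ (subst (_≤ suc m) (+-suc (length (g ∷ gs)) (length hs)) len))
    sg (Linked.tail sh)
    (Hall-dropʳ (Linked⇒All ≤-trans (<⇒≤ (≰⇒> g≰h)) sg) (head≤all sh) hall))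

elems-sorted : ∀ {n} (X : Subset n) → Linked _≤_ (elems X)
elems-sorted X = Linked.map <⇒≤ (Linked.tail (elemsFrom-increasing 0 X))

elems-≤ : ∀ {n} (X : Subset n) → All (_≤ n) (elems X)
elems-≤ X = All.map proj₂ (elemsFrom-between 0 X)

Uncrowded : ℕ → List ℕ → List ℕ → Set
Uncrowded n gs hs = ∀ l → 1 ≤ l → l ≤ n → countLe l gs + countLe l hs ≤ l

Uncrowded⇒Hall : ∀ {n gs hs} → All (Between 0 n) gs → All (Between 0 n) hs →
  Uncrowded n gs hs → Hall 0 gs hs
Uncrowded⇒Hall gs∈ hs∈ uncrowded =
  mkHall λ {x} x∈ → uncurry (uncrowded x) ([ All.lookup gs∈ , All.lookup hs∈ ]′ x∈)

Crowded : ∀ {n} → Subset n → Subset n → Set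
Crowded {n} G H = ∃[ l ] (1 ≤ l × l ≤ n × l < μ G l + μ H l)

crowded? : ∀ {n} (G H : Subset n) → Dec (Crowded G H)
crowded? {n} G H =
  map′ (λ (l , l<1+n , 1≤l , over) → l , 1≤l , s≤s⁻¹ l<1+n , over)
       (λ (l , 1≤l , l≤n , over) → l , s≤s l≤n , 1≤l , over)
       (anyUpTo? (λ l → 1 ≤? l ×-dec l <? μ G l + μ H l) (suc n))

¬crowded⇒uncrowded : ∀ {n} (G H : Subset n) → ¬ Crowded G H → Uncrowded n (elems G) (elems H)
¬crowded⇒uncrowded G H ¬crowded l 1≤l l≤n = ≮⇒≥ (λ over → ¬crowded (l , 1≤l , l≤n , over))

crowded⇒intersecting : ∀ {n} (G H S T : Subset n) → Crowded G H → S ⪯ G → T ⪯ H → Nonempty (S ∩ T)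
crowded⇒intersecting G H S T (l , _ , _ , over) S⪯G T⪯H =
  decidable-stable (nonempty? (S ∩ T)) λ empty →
    <⇒≱ (<-≤-trans over (+-mono-≤ (countLe-antitone l (elems S) (elems G) S⪯G)
                                   (countLe-antitone l (elems T) (elems H) T⪯H)))
        (disjoint⇒countLe≤ l 0 S T empty)

elems-length-bound : ∀ {n} (G H : Subset n) → Uncrowded n (elems G) (elems H) →
  length (elems G) + length (elems H) ≤ n
elems-length-bound {zero}  []  [] _         = z≤n
elems-length-bound {suc n} G H uncrowded =
  subst (_≤ suc n) (cong₂ _+_ (countLe-length (elems-≤ G)) (countLe-length (elems-≤ H)))
    (uncrowded (suc n) z<s ≤-refl)

uncrowded⇒¬SI : ∀ {n} (G H : Subset n) → Uncrowded n (elems G) (elems H) → ¬ StronglyIntersecting G H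
uncrowded⇒¬SI G H uncrowded si =
  disjoint (si S T ∣S∣≡∣G∣ (∣S∣≡∣G∣ , S≼gs) ∣T∣≡∣H∣ (∣T∣≡∣H∣ , T≼hs))
  where
  open Separation (separate _ 0 (elems G) (elems H) (elems-length-bound G H uncrowded)
    (elems-sorted G) (elems-sorted H)
    (Uncrowded⇒Hall (elemsFrom-between 0 G) (elemsFrom-between 0 H) uncrowded))
  ∣S∣≡∣G∣ : ∣ S ∣ ≡ ∣ G ∣
  ∣S∣≡∣G∣ = trans ∣S∣≡ (sym (∣∣≡length-elemsFrom 0 G))
  ∣T∣≡∣H∣ : ∣ T ∣ ≡ ∣ H ∣
  ∣T∣≡∣H∣ = trans ∣T∣≡ (sym (∣∣≡length-elemsFrom 0 H))

module Padding {n : ℕ} (k : ℕ) (1≤n : 1 ≤ n) where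

  pad : Subset n → List ℕ
  pad X = elems X ++ replicate (k ∸ ∣ X ∣) n

  pad-length : (X : Subset n) → ∣ X ∣ ≤ k → length (pad X) ≡ k
  pad-length X X≤k = begin
    length (elems X ++ replicate (k ∸ ∣ X ∣) n)
      ≡⟨ length-++ (elems X) ⟩
    length (elems X) + length (replicate (k ∸ ∣ X ∣) n)
      ≡⟨ cong₂ _+_ (sym (∣∣≡length-elemsFrom 0 X)) (length-replicate _) ⟩
    ∣ X ∣ + (k ∸ ∣ X ∣)
      ≡⟨ m+[n∸m]≡n X≤k ⟩
    k ∎
    where open ≡-Reasoning

  pad-between : (X : Subset n) → All (Between 0 n) (pad X)
  pad-between X = ++⁺ (elemsFrom-between 0 X) (replicate⁺ _ (1≤n , ≤-refl))

  pad-sorted : (X : Subset n) → Linked _≤_ (pad X)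
  pad-sorted X = ++-replicate-sorted _ (elems-≤ X) (elems-sorted X)

  countLe-pad-< : ∀ {l} (X : Subset n) → l < n → countLe l (pad X) ≡ μ X l
  countLe-pad-< {l} X l<n = begin
    countLe l (pad X)
      ≡⟨ countLe-++ l (elems X) _ ⟩
    μ X l + countLe l (replicate (k ∸ ∣ X ∣) n)
      ≡⟨ cong (μ X l +_) (countLe-zero (replicate⁺ (k ∸ ∣ X ∣) l<n)) ⟩
    μ X l + 0
      ≡⟨ +-identityʳ _ ⟩
    μ X l ∎
    where open ≡-Reasoning

  countLe-pad-n : (X : Subset n) → ∣ X ∣ ≤ k → countLe n (pad X) ≡ k
  countLe-pad-n X X≤k = trans (countLe-length (All.map proj₂ (pad-between X))) (pad-length X X≤k)

  module _ (2k≤n : 2 * k ≤ n) (G H : Subset n) (G≤k : ∣ G ∣ ≤ k) (H≤k : ∣ H ∣ ≤ k) where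

    k+k≤n : k + k ≤ n
    k+k≤n = subst (_≤ n) (cong (k +_) (+-identityʳ k)) 2k≤n

    pad-uncrowded : Uncrowded n (elems G) (elems H) → Uncrowded n (pad G) (pad H)
    pad-uncrowded uncrowded l 1≤l l≤n with m≤n⇒m<n∨m≡n l≤n
    ... | inj₁ l<n  rewrite countLe-pad-< G l<n | countLe-pad-< H l<n = uncrowded l 1≤l l≤n
    ... | inj₂ refl rewrite countLe-pad-n G G≤k | countLe-pad-n H H≤k = k+k≤n

    uncrowded⇒¬CI : Uncrowded n (elems G) (elems H) → ¬ CrossIntersecting (InF k G) (InF k H)
    uncrowded⇒¬CI uncrowded ci = disjoint
      (ci S T (trans ∣S∣≡ (pad-length G G≤k) , PrefLe-++⁻ (elems S) (elems G) _ S≼gs)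
              (trans ∣T∣≡ (pad-length H H≤k) , PrefLe-++⁻ (elems T) (elems H) _ T≼hs))
      where
      open Separation (separate n 0 (pad G) (pad H)
        (subst (_≤ n) (sym (cong₂ _+_ (pad-length G G≤k) (pad-length H H≤k))) k+k≤n)
        (pad-sorted G) (pad-sorted H)
        (Uncrowded⇒Hall (pad-between G) (pad-between H) (pad-uncrowded uncrowded)))

crowded⇒SI : ∀ {n} (G H : Subset n) → Crowded G H → StronglyIntersecting G H
crowded⇒SI G H crowded S T _ (_ , S⪯G) _ (_ , T⪯H) =
  crowded⇒intersecting G H S T crowded S⪯G T⪯H

crowded⇒CI : ∀ {n} k (G H : Subset n) → Crowded G H → CrossIntersecting (InF k G) (InF k H)
crowded⇒CI k G H crowded S T (_ , S⪯G) (_ , T⪯H) =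
  crowded⇒intersecting G H S T crowded S⪯G T⪯H

SI⇒crowded : ∀ {n} (G H : Subset n) → StronglyIntersecting G H → Crowded G H
SI⇒crowded G H si =
  decidable-stable (crowded? G H) λ ¬crowded →
    uncrowded⇒¬SI G H (¬crowded⇒uncrowded G H ¬crowded) si

CI⇒crowded : ∀ {n} k (G H : Subset n) → 1 ≤ n → 2 * k ≤ n → ∣ G ∣ ≤ k → ∣ H ∣ ≤ k →
  CrossIntersecting (InF k G) (InF k H) → Crowded G H
CI⇒crowded k G H 1≤n 2k≤n G≤k H≤k ci =
  decidable-stable (crowded? G H) λ ¬crowded →
    Padding.uncrowded⇒¬CI k 1≤n 2k≤n G H G≤k H≤k (¬crowded⇒uncrowded G H ¬crowded) ci

lemma2p3 : (n k : ℕ) → 1 ≤ k → 4 ≤ 2 * k → 2 * k ≤ n →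
    (G H : Subset n) → ∣ G ∣ ≤ k → ∣ H ∣ ≤ k →
    (StronglyIntersecting G H ⇔ CrossIntersecting (InF k G) (InF k H))
    × (StronglyIntersecting G H ⇔ (∃[ l ] (1 ≤ l × l ≤ n × l < μ G l + μ H l)))
lemma2p3 n k 1≤k _ 2k≤n G H G≤k H≤k =
  mk⇔ (crowded⇒CI k G H ∘ SI⇒crowded G H)
      (crowded⇒SI G H ∘ CI⇒crowded k G H 1≤n 2k≤n G≤k H≤k) ,
  mk⇔ (SI⇒crowded G H) (crowded⇒SI G H)
  where
  1≤n : 1 ≤ n
  1≤n = ≤-trans 1≤k (≤-trans (m≤m+n k (k + 0)) 2k≤n)
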